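{- Let $\mathcal A=\langle A_1,\dots,A_N\rangle$ be a network and $B$ an observer as in the context, with $\vec x_i=\vec x^g\cup\vec x^\ell_i$ for all $i$, where the only variables shared by more than one component are those of $\vec x^g$. For each $i\in[1,N]$ let $R_i\subseteq Q_i\times\mathcal D^{\vec x_i}\times Q_i$ be a data simulation for $A_i$ such that, whenever $(q_i,\nu,r_i)\in R_i$ and $\nu'\in\mathcal D^{\vec x_i}$ satisfies $\nu\!\downarrow_{\vec x^\ell_i}=\nu'\!\downarrow_{\vec x^\ell_i}$, also $(q_i,\nu',r_i)\in R_i$; and let $R_B\subseteq Q_B\times\mathcal D^{\vec x_B}\times Q_B$ be a data simulation for $B$. Define $(\langle q_1,\dots,q_N\rangle,P,\Phi)\sqsubseteq_{\mathit{sim}}(\langle r_1,\dots,r_N\rangle,S,\Psi)$ iff for all $i\in[1,N]$ and all $\nu\in\mathcal D^{\vec x_{\mathcal A}}$, $\nu\models\Phi$ implies that $\nu\models\Psi$, $(q_i,\nu\!\downarrow_{\vec x_i},r_i)\in R_i$, and for every $p\in S$ there exists $q\in P$ with $(p,\nu\!\downarrow_{\vec x_B},q)\in R_B$. Then whenever $s\sqsubseteq_{\mathit{sim}}t$ we have $\mathcal L_s(\mathcal A^e\times\overline B)\subseteq\mathcal L_t(\mathcal A^e\times\overline B)$, i.e. $\sqsubseteq_{\mathit{sim}}$ is a subsumption relation.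
   Context: Data automata (DA): $\mathcal{D}$ is a data domain with first-order theory $\mathrm{Th}(\mathcal D)$ closed under conjunction and negation; a DA $\langle\mathcal D,\Sigma,\vec x,Q,\iota,F,\Delta\rangle$ has finite alphabet $\Sigma$ containing padding symbol $\diamond$, finite variables $\vec x$, finite states $Q$, initial $\iota$, final $F$, rules $q\xrightarrow{\sigma,\phi(\vec x,\vec x')}q'$ with $\phi\in\mathrm{Th}(\mathcal D)$. Write $(q,\nu)\xrightarrow{\sigma}(q',\nu')$ if some rule $q\xrightarrow{\sigma,\phi}q'$ has $(\nu,\nu')\models\phi$. A trace is $(\nu_0,\sigma_0),\dots,(\nu_{n-1},\sigma_{n-1}),(\nu_n,\diamond)$; a run over it from $(q_0,\nu_0)$ is $(q_0,\nu_0)\xrightarrow{\sigma_0}\cdots\xrightarrow{\sigma_{n-1}}(q_n,\nu_n)$, accepting if $q_n\in F$; the residual language $\mathcal L_{(q,\nu)}(A)$ is the set of traces with an accepting run from $(q,\nu)$ (so with first valuation $\nu$). A relation $R\subseteq Q\times\mathcal D^{\vec x}\times Q$ is a data simulation for $A$ if for all $(q,\nu,q')\in R$: $q\in F$ implies $q'\in F$, and whenever $(q,\nu)\xrightarrow{\sigma}(r,\nu')$ there is $r'$ with $(q',\nu)\xrightarrow{\sigma}(r',\nu')$ and $(r,\nu',r')\in R$. $\nu\!\downarrow_{\vec y}$ denotes restriction of a valuation to $\vec y$. Network $\mathcal A=\langle A_1,\dots,A_N\rangle$, $A_i=\langle\mathcal D,\Sigma_i,\vec x_i,Q_i,\iota_i,F_i,\Delta_i\rangle$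 with disjoint state sets; expansion $\mathcal A^e$: variables $\vec x_{\mathcal A}=\bigcup\vec x_i$, states $Q_1\times\dots\times Q_N$, final $F_1\times\dots\times F_N$, rules $\langle q_1,\dots,q_N\rangle\xrightarrow{\sigma,\varphi}\langle q_1',\dots,q_N'\rangle$ where with $I$ the indices $i$ having a rule $q_i\xrightarrow{\sigma,\varphi_i}q_i'\in\Delta_i$, $q_j=q_j'$ for $j\notin I$ and $\varphi\equiv\bigwedge_{i\in I}\varphi_i\wedge\bigwedge_{j\notin I}\bigwedge_{x\in\vec x_j\setminus\bigcup_{i\in I}\vec x_i}x'=x$. Observer DA $B=\langle\mathcal D,\Sigma,\vec x_B,Q_B,\iota_B,F_B,\Delta_B\rangle$ with $\vec x_B\subseteq\vec x_{\mathcal A}$; complement $\overline B$ with states $2^{Q_B}$, final states $\{P\mid P\cap F_B=\emptyset\}$, rules $P\xrightarrow{\sigma,\theta}P'$ whenever every $p'\in P'$ has a $\sigma$-rule from some $p\in P$, $\theta\equiv\bigwedge_{p'\in P'}\bigvee_{p\in P,\,p\xrightarrow{\sigma,\psi}p'\in\Delta_B}\psi\wedge\bigwedge_{p'\notin P'}\bigwedge_{p\in P,\,p\xrightarrow{\sigma,\varphi}p'\in\Delta_B}\neg\varphi$. Product $\mathcal A^e\times\overline B$: variables $\vec x_{\mathcal A}$, states $(\vec q,P)$, final states $(F_1\times\dots\times F_N)\times\{P\mid P\cap F_B=\emptyset\}$, rules $(\vec q,P)\xrightarrow{\sigma,\varphi\wedge\theta}(\vec q',P')$ for rules $\vec q\xrightarrow{\sigma,\varphi}\vec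 q'$ of $\mathcal A^e$ and $P\xrightarrow{\sigma,\theta}P'$ of $\overline B$. A product state $s=(\vec q,P,\Phi)$, $\Phi(\vec x_{\mathcal A})\in\mathrm{Th}(\mathcal D)$, denotes $[\![s]\!]=\{(\vec q,P,\nu)\mid\nu\models\Phi\}$, and $\mathcal L_s(\mathcal A^e\times\overline B)=\bigcup_{(\vec q,P,\nu)\in[\![s]\!]}\mathcal L_{(\vec q,P,\nu)}(\mathcal A^e\times\overline B)$. A partial order $\sqsubseteq$ on product states is a subsumption if $s\sqsubseteq t$ implies $\mathcal L_s\subseteq\mathcal L_t$. -}

module Defs where

open import Data.Nat using (ℕ)
open import Data.Fin using (Fin)
open import Data.Fin.Subset using (Subset; _∈_; _∉_; _∪_; _∩_; Empty)
open import Data.Bool using (Bool; T; not)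
open import Data.List using (List)
open import Data.List.Relation.Unary.Any using (Any)
open import Data.List.Relation.Unary.All using (All)
open import Data.Product using (Σ; ∃; _×_; _,_; proj₁)
open import Relation.Binary.PropositionalEquality using (_≡_)

-- Variables are Fin V; a set of variables is a Subset V.
-- A valuation of a set of variables y (an element of D^y) is a function
-- on the elements of y.

Elem : ∀ {V} → Subset V → Set
Elem {V} y = Σ (Fin V) (λ v → v ∈ y)

_↓_ : ∀ {D : Set} {V} → (Fin V → D) → (y : Subset V) → (Elem y → D)
(ν ↓ y) e = ν (proj₁ e)

-- Data automata.  Formulae φ(x, x') of Th(D) are represented by their
-- (two-valued) interpretation; alphabet = Fin nΣ, states = Fin nQ.

record Rule (D : Set) (nΣ : ℕ) (X : Set) (nQ : ℕ) : Set where
  field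
    src : Fin nQ
    lab : Fin nΣ
    grd : (X → D) → (X → D) → Bool
    tgt : Fin nQ

record DA (D : Set) (nΣ : ℕ) (X : Set) : Set where
  field
    nQ : ℕ
    ι  : Fin nQ
    F  : Subset nQ
    Δ  : List (Rule D nΣ X nQ)

open Rule
open DA

Step : ∀ {D nΣ X} (A : DA D nΣ X) → Fin (nQ A) → (X → D) → Fin nΣ
       → Fin (nQ A) → (X → D) → Set
Step A q ν σ q' ν' =
  Any (λ r → src r ≡ q × lab r ≡ σ × tgt r ≡ q' × T (grd r ν ν')) (Δ A)

DataSim : ∀ {D nΣ X} (A : DA D nΣ X)
          → (Fin (nQ A) → (X → D) → Fin (nQ A) → Set) → Set
DataSim A R = ∀ q ν q' → R q ν q' →
    (q ∈ F A → q' ∈ F A)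
  × (∀ σ r ν' → Step A q ν σ r ν' →
       ∃ λ r' → Step A q' ν σ r' ν' × R r ν' r')

-- Traces (ν0,σ0),…,(ν_{n-1},σ_{n-1}),(ν_n,◇): the final padding symbol ◇
-- is implicit in the constructor 'end'.

data Trace (Val : Set) (nΣ : ℕ) : Set where
  end  : Val → Trace Val nΣ
  cons : Val → Fin nΣ → Trace Val nΣ → Trace Val nΣ

data Acc {S Val : Set} {nΣ : ℕ}
         (step : S → Val → Fin nΣ → S → Val → Set) (fin : S → Set)
         : S → Val → Trace Val nΣ → Set where
  acc-end  : ∀ {s ν} → fin s → Acc step fin s ν (end ν)
  acc-step : ∀ {s ν σ s' ν' t} → step s ν σ s' ν' → Acc step fin s' ν' t
           → Acc step fin s ν (cons ν σ t)

record Net (D : Set) (nΣ V N : ℕ) : Set₁ where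
  field
    xg : Subset V
    xl : Fin N → Subset V
    A  : (i : Fin N) → DA D nΣ (Elem (xg ∪ xl i))
    xB : Subset V
    B  : DA D nΣ (Elem xB)

  x : Fin N → Subset V
  x i = xg ∪ xl i

  QE : Set
  QE = (i : Fin N) → Fin (nQ (A i))

  QC : Set
  QC = Subset (nQ B)

  ExpStep : QE → (Fin V → D) → Fin nΣ → QE → (Fin V → D) → Set
  ExpStep qs ν σ qs' ν' = ∃ λ (I : Subset N) →
      (∀ i → i ∈ I → Step (A i) (qs i) (ν ↓ x i) σ (qs' i) (ν' ↓ x i))
    × (∀ j → j ∉ I → qs j ≡ qs' j)
    × (∀ j → j ∉ I → ∀ v → v ∈ x j → (∀ i → i ∈ I → v ∉ x i) → ν' v ≡ ν v)

  CompStep : QC → (Elem xB → D) → Fin nΣ → QC → (Elem xB → D) → Set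
  CompStep P μ σ P' μ' =
      (∀ p' → p' ∈ P' →
         Any (λ r → src r ∈ P × lab r ≡ σ × tgt r ≡ p') (Δ B))
    × (∀ p' → p' ∈ P' →
         Any (λ r → src r ∈ P × lab r ≡ σ × tgt r ≡ p' × T (grd r μ μ')) (Δ B))
    × (∀ p' → p' ∉ P' →
         All (λ r → src r ∈ P → lab r ≡ σ → tgt r ≡ p' → T (not (grd r μ μ'))) (Δ B))

  PState : Set
  PState = QE × QC

  ProdStep : PState → (Fin V → D) → Fin nΣ → PState → (Fin V → D) → Set
  ProdStep (qs , P) ν σ (qs' , P') ν' =
    ExpStep qs ν σ qs' ν' × CompStep P (ν ↓ xB) σ P' (ν' ↓ xB)

  ProdFinal : PState → Set
  ProdFinal (qs , P) = (∀ i → qs i ∈ F (A i)) × Empty (P ∩ F B)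

  SState : Set
  SState = QE × QC × ((Fin V → D) → Bool)

  Lang : SState → Trace (Fin V → D) nΣ → Set
  Lang (qs , P , Φ) tr = ∃ λ ν → T (Φ ν) × Acc ProdStep ProdFinal (qs , P) ν tr

  SimSub : (R : (i : Fin N) → Fin (nQ (A i)) → (Elem (x i) → D) → Fin (nQ (A i)) → Set)
         → (RB : Fin (nQ B) → (Elem xB → D) → Fin (nQ B) → Set)
         → SState → SState → Set
  SimSub R RB (qs , P , Φ) (rs , S , Ψ) = ∀ ν → T (Φ ν) →
      T (Ψ ν)
    × (∀ i → R i (qs i) (ν ↓ x i) (rs i))
    × (∀ p → p ∈ S → ∃ λ q → q ∈ P × RB p (ν ↓ xB) q)

module Submission where

-- The proof is a forward-simulation argument on the product A^e × B̄.
--   * A relation Inv on states (indexed by the current valuation) that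
--     preserves finality and lets the second state match every step of the
--     first transports accepting runs (acc-transfer).  The language
--     inclusion follows once ⊑sim is seen to induce such a relation.
--   * Expansion: the componentwise relation "R i (q i) (ν↓x i) (r i) for all
--     i" is a simulation of A^e.  A firing component is matched by its own
--     simulation R i; an idle component stays put, and its local variables
--     are unchanged because no other component owns them, so the locality
--     of R i keeps it related.
--   * Complement: B̄ is the subset construction, so the successor P' of P
--     contains every B-successor of P (successors-closed).  Taking for S' the
--     exact set of B-successors of S (post), the invariant "every p ∈ S is
--     RB-simulated by some q ∈ P" is preserved by the forward simulation RB,
--     and it makes S rejecting whenever P is.
-- The product invariant is the conjunction of the two, and lemma11 is
-- acc-transfer applied to it.

open import Defs
open import Data.Nat using (ℕ)
open import Data.Fin using (Fin; _≟_)
open import Data.Fin.Subset using (Subset; _∈_; _∉_; _∩_; Empty)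
open import Data.Fin.Subset.Properties using (_∈?_; x∈p∩q⁺; x∈p∩q⁻)
open import Data.Bool using (true; false; T; not)
open import Data.Unit using (tt)
open import Data.Empty using (⊥-elim)
open import Data.Product using (Σ; ∃; _×_; _,_; proj₁; proj₂)
open import Data.Vec using (tabulate)
open import Data.Vec.Properties using (lookup∘tabulate; []=⇒lookup; lookup⇒[]=)
open import Data.List using (List)
open import Data.List.Relation.Unary.Any as Any using (Any; here; there; any?)
open import Data.List.Relation.Unary.All as All using (All)
open import Data.List.Relation.Unary.All.Properties using (¬Any⇒All¬)
open import Relation.Nullary using (Dec; yes; no; ¬_; does; contradiction)
open import Relation.Nullary.Decidable using (_×-dec_; T?)
open import Relation.Binary.PropositionalEquality
  using (_≡_; _≢_; refl; sym; trans; subst)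

open Rule
open DA

T-not-intro : ∀ b → ¬ T b → T (not b)
T-not-intro true  ¬b = ¬b tt
T-not-intro false _  = tt

T-not-elim : ∀ b → T (not b) → ¬ T b
T-not-elim true  () _
T-not-elim false _  ()

any-source : ∀ {A : Set} {n} {f : A → Fin n} {S : Subset n} {Q : A → Set} {xs : List A} →
             Any (λ r → f r ∈ S × Q r) xs →
             ∃ λ p → p ∈ S × Any (λ r → f r ≡ p × Q r) xs
any-source (here (fr∈S , q)) = _ , fr∈S , here (refl , q)
any-source (there a) with any-source a
... | p , p∈S , a' = p , p∈S , there a'

select : ∀ {n} {P : Fin n → Set} → (∀ i → Dec (P i)) → Subset n
select d = tabulate (λ i → does (d i))

∈-select⁻ : ∀ {n} {P : Fin n → Set} (d : ∀ i → Dec (P i)) i → i ∈ select d → P i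
∈-select⁻ d i i∈ with d i | trans (sym (lookup∘tabulate (λ j → does (d j)) i)) ([]=⇒lookup i∈)
... | yes p | _ = p
... | no _  | ()

∈-select⁺ : ∀ {n} {P : Fin n → Set} (d : ∀ i → Dec (P i)) i → P i → i ∈ select d
∈-select⁺ d i p = lookup⇒[]= i _ (trans (lookup∘tabulate (λ j → does (d j)) i) (selected (d i)))
  where
  selected : (di : Dec _) → does di ≡ true
  selected (yes _) = refl
  selected (no ¬p) = contradiction p ¬p

record Simulation {S Val : Set} {nΣ : ℕ}
                  (step : S → Val → Fin nΣ → S → Val → Set) (fin : S → Set)
                  (Inv : S → S → Val → Set) : Set where
  field
    final : ∀ {s t ν} → Inv s t ν → fin s → fin t
    match : ∀ {s t ν σ s' ν'} → Inv s t ν → step s ν σ s' ν' →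
            ∃ λ t' → step t ν σ t' ν' × Inv s' t' ν'

acc-transfer : ∀ {S Val : Set} {nΣ : ℕ}
               {step : S → Val → Fin nΣ → S → Val → Set} {fin : S → Set}
               {Inv : S → S → Val → Set} → Simulation step fin Inv →
               ∀ {s t ν tr} → Inv s t ν → Acc step fin s ν tr → Acc step fin t ν tr
acc-transfer sim inv (acc-end fs) = acc-end (Simulation.final sim inv fs)
acc-transfer sim inv (acc-step st rest) with Simulation.match sim inv st
... | _ , st' , inv' = acc-step st' (acc-transfer sim inv' rest)

module _ {D : Set} {nΣ V N : ℕ} (net : Net D nΣ V N) where
  open Net net

  module Expansion
    (disj : ∀ i → Empty (xg ∩ xl i))
    (shared : ∀ i j → i ≢ j → ∀ v → v ∈ x i → v ∈ x j → v ∈ xg)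
    (R : (i : Fin N) → Fin (nQ (A i)) → (Elem (x i) → D) → Fin (nQ (A i)) → Set)
    (simR : ∀ i → DataSim (A i) (R i))
    (loc : ∀ i q r (ν ν' : Elem (x i) → D) → R i q ν r →
       (∀ v (p : v ∈ x i) → v ∈ xl i → ν (v , p) ≡ ν' (v , p)) → R i q ν' r)
    where

    ExpInv : QE → QE → (Fin V → D) → Set
    ExpInv qs rs ν = ∀ i → R i (qs i) (ν ↓ x i) (rs i)

    -- The frame condition of an A^e step leaves the local variables of
    -- every idle component unchanged: only global variables are shared,
    -- so no firing component owns them.
    idle-locals : ∀ {ν ν' : Fin V → D} (I : Subset N) →
      (∀ j → j ∉ I → ∀ v → v ∈ x j → (∀ i → i ∈ I → v ∉ x i) → ν' v ≡ ν v) →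
      ∀ j → j ∉ I → ∀ v → v ∈ x j → v ∈ xl j → ν v ≡ ν' v
    idle-locals I frame j j∉I v v∈xj v∈xlj = sym (frame j j∉I v v∈xj unowned)
      where
      unowned : ∀ i → i ∈ I → v ∉ x i
      unowned i i∈I v∈xi = disj j (v , x∈p∩q⁺ (shared i j i≢j v v∈xi v∈xj , v∈xlj))
        where
        i≢j : i ≢ j
        i≢j refl = j∉I i∈I

    Follow : ∀ {qs' : QE} {ν' : Fin V → D} (rs : QE) (ν : Fin V → D) (σ : Fin nΣ)
             (I : Subset N) (i : Fin N) → Set
    Follow {qs'} {ν'} rs ν σ I i = Σ (Fin (nQ (A i))) λ r' →
        (i ∈ I → Step (A i) (rs i) (ν ↓ x i) σ r' (ν' ↓ x i))
      × (i ∉ I → rs i ≡ r')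
      × R i (qs' i) (ν' ↓ x i) r'

    -- Each component follows: firing ones by simR, idle ones by locality.
    follow : ∀ {qs rs ν σ qs' ν'} → ExpInv qs rs ν →
             ((I , _) : ExpStep qs ν σ qs' ν') → ∀ i → Follow {qs'} {ν'} rs ν σ I i
    follow inv (I , fire , idle , frame) i with i ∈? I
    ... | yes i∈I =
      let (r' , st , rel) = proj₂ (simR i _ _ _ (inv i)) _ _ _ (fire i i∈I)
      in r' , (λ _ → st) , (λ i∉I → contradiction i∈I i∉I) , rel
    ... | no i∉I =
      _ , (λ i∈I → contradiction i∈I i∉I) , (λ _ → refl) ,
      loc i _ _ _ _ (subst (λ q → R i q _ _) (idle i i∉I) (inv i))
                    (idle-locals I frame i i∉I)

    expansion-sim : ∀ {qs rs ν σ qs' ν'} → ExpInv qs rs ν → ExpStep qs ν σ qs' ν' →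
                    ∃ λ rs' → ExpStep rs ν σ rs' ν' × ExpInv qs' rs' ν'
    expansion-sim {rs = rs} {ν} {σ} {qs'} {ν'} inv st@(I , _ , _ , frame) =
      (λ i → proj₁ (follows i)) ,
      (I , (λ i → proj₁ (proj₂ (follows i))) , (λ i → proj₁ (proj₂ (proj₂ (follows i)))) , frame) ,
      (λ i → proj₂ (proj₂ (proj₂ (follows i))))
      where
      follows : ∀ i → Follow {qs'} {ν'} rs ν σ I i
      follows = follow inv st

    expansion-final : ∀ {qs rs ν} → ExpInv qs rs ν →
                      (∀ i → qs i ∈ F (A i)) → ∀ i → rs i ∈ F (A i)
    expansion-final inv fin i = proj₁ (simR i _ _ _ (inv i)) (fin i)

  module Complement where

    Enters : QC → (Elem xB → D) → Fin nΣ → (Elem xB → D) → Fin (nQ B) →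
             Rule D nΣ (Elem xB) (nQ B) → Set
    Enters S μ σ μ' p' r = src r ∈ S × lab r ≡ σ × tgt r ≡ p' × T (grd r μ μ')

    -- Guards are Booleans, so entering is decidable.
    enters? : ∀ S μ σ μ' p' → Dec (Any (Enters S μ σ μ' p') (Δ B))
    enters? S μ σ μ' p' =
      any? (λ r → (src r ∈? S) ×-dec ((lab r ≟ σ) ×-dec ((tgt r ≟ p') ×-dec T? (grd r μ μ')))) (Δ B)

    post : QC → (Elem xB → D) → Fin nΣ → (Elem xB → D) → QC
    post S μ σ μ' = select (enters? S μ σ μ')

    post-step : ∀ S μ σ μ' → CompStep S μ σ (post S μ σ μ') μ'
    post-step S μ σ μ' = enabled , entered , blocked
      where
      entered : ∀ p' → p' ∈ post S μ σ μ' → Any (Enters S μ σ μ' p') (Δ B)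
      entered = ∈-select⁻ (enters? S μ σ μ')

      enabled : ∀ p' → p' ∈ post S μ σ μ' → Any (λ r → src r ∈ S × lab r ≡ σ × tgt r ≡ p') (Δ B)
      enabled p' p'∈ = Any.map (λ (s , l , t , _) → s , l , t) (entered p' p'∈)

      blocked : ∀ p' → p' ∉ post S μ σ μ' →
                All (λ r → src r ∈ S → lab r ≡ σ → tgt r ≡ p' → T (not (grd r μ μ'))) (Δ B)
      blocked p' p'∉ =
        All.map (λ {r} ¬enters s l t → T-not-intro (grd r μ μ') (λ g → ¬enters (s , l , t , g)))
                (¬Any⇒All¬ (Δ B) (λ a → p'∉ (∈-select⁺ (enters? S μ σ μ') p' a)))

    successors-closed : ∀ {P μ σ P' μ' q q'} → CompStep P μ σ P' μ' →
                        q ∈ P → Step B q μ σ q' μ' → q' ∈ P'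
    successors-closed {P} {μ} {P' = P'} {μ'} {q' = q'} (_ , _ , blocked) q∈P st with q' ∈? P'
    ... | yes q'∈P' = q'∈P'
    ... | no q'∉P' with All.lookupAny (blocked q' q'∉P') st
    ... | blocks , s , l , t , g =
      ⊥-elim (T-not-elim (grd (Any.lookup st) μ μ') (blocks (subst (_∈ P) (sym s) q∈P) l t) g)

    CompInv : (RB : Fin (nQ B) → (Elem xB → D) → Fin (nQ B) → Set) →
              QC → QC → (Elem xB → D) → Set
    CompInv RB P S μ = ∀ p → p ∈ S → ∃ λ q → q ∈ P × RB p μ q

    module _ {RB : Fin (nQ B) → (Elem xB → D) → Fin (nQ B) → Set} (simB : DataSim B RB) where

      -- If P moves to P', then post S moves with it: each successor p' of
      -- some p ∈ S is simulated by a successor q' of q, and q' ∈ P'.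
      complement-sim : ∀ {P S μ σ P' μ'} → CompInv RB P S μ → CompStep P μ σ P' μ' →
                       CompInv RB P' (post S μ σ μ') μ'
      complement-sim {S = S} {μ} {σ} {μ' = μ'} inv st p' p'∈post
        with any-source (∈-select⁻ (enters? S μ σ μ') p' p'∈post)
      ... | p , p∈S , stp with inv p p∈S
      ... | q , q∈P , rel with proj₂ (simB p μ q rel) σ p' μ' stp
      ... | q' , stq , rel' = q' , successors-closed st q∈P stq , rel'

      -- If P is rejecting (accepting in B̄), so is S: an accepting p ∈ S
      -- would be simulated by an accepting q ∈ P.
      complement-final : ∀ {P S μ} → CompInv RB P S μ → Empty (P ∩ F B) → Empty (S ∩ F B)
      complement-final {P} {S} inv rejP (p , p∈S∩F) with x∈p∩q⁻ S (F B) p∈S∩F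
      ... | p∈S , p∈F with inv p p∈S
      ... | q , q∈P , rel = rejP (q , x∈p∩q⁺ (q∈P , proj₁ (simB p _ q rel) p∈F))

-- The theorem.
lemma11 : ∀ {D : Set} {nΣ V N : ℕ} (net : Net D nΣ V N) →
    let open Net net in
    (∀ v → ∃ λ i → v ∈ x i) →
    (∀ i → Empty (xg ∩ xl i)) →
    (∀ i j → i ≢ j → ∀ v → v ∈ x i → v ∈ x j → v ∈ xg) →
    (R : (i : Fin N) → Fin (DA.nQ (A i)) → (Elem (x i) → D) → Fin (DA.nQ (A i)) → Set) →
    (∀ i → DataSim (A i) (R i)) →
    (∀ i q r (ν ν' : Elem (x i) → D) → R i q ν r →
    (∀ v (p : v ∈ x i) → v ∈ xl i → ν (v , p) ≡ ν' (v , p)) → R i q ν' r) →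
    (RB : Fin (DA.nQ B) → (Elem xB → D) → Fin (DA.nQ B) → Set) →
    DataSim B RB →
    (s t : SState) → SimSub R RB s t →
    ∀ tr → Lang s tr → Lang t tr
lemma11 {D} {V = V} net _ disj shared R simR loc RB simB (_ , _ , _) (_ , _ , _) s⊑t tr (ν , Φν , run) =
  let (Ψν , invA , invB) = s⊑t ν Φν
  in ν , Ψν , acc-transfer product-sim (invA , invB) run
  where
  open Net net
  open Expansion net disj shared R simR loc
  open Complement net

  Inv : PState → PState → (Fin V → D) → Set
  Inv (qs , P) (rs , S) ν = ExpInv qs rs ν × CompInv RB P S (ν ↓ xB)

  product-sim : Simulation ProdStep ProdFinal Inv
  product-sim = record
    { final = λ (invA , invB) (finA , rejB) →
        expansion-final invA finA , complement-final simB invB rejB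
    ; match = λ { {_ , _} {rs , S} {ν} {σ} {_ , _} {ν'} (invA , invB) (stA , stB) →
        let (rs' , stA' , invA') = expansion-sim invA stA
        in (rs' , post S (ν ↓ xB) σ (ν' ↓ xB)) ,
           (stA' , post-step S _ σ _) ,
           (invA' , complement-sim simB invB stB) }
    }
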